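{- Each component of a weighted Hankel graph is isomorphic to a weighted Hankel graph under the normalized labeling of its vertex set.
   Context: For real numbers $a_0,\ldots,a_{2n-2}$, $H[a_0,\ldots,a_{2n-2}]$ denotes the $n\times n$ Hankel matrix whose entry in row $i$, column $j$ (indexed $0,\ldots,n-1$) is $a_{i+j}$. For such $A$, $T_A=\{i\colon\, a_i\neq 0\}$ and $w_A(t)=a_t$. The weighted Hankel graph $G(A)$ of a Hankel matrix $A$ is the edge-weighted graph (loops allowed) with vertex set $\{0,1,\ldots,n-1\}$, where $i$ and $j$ are adjacent iff $i+j\in T_A$, with edge $ij$ of weight $w_A(i+j)$. A component is a maximal connected subgraph. If the vertex set of a component is $n_0<n_1<\cdots<n_{k-1}$, its normalized labeling is the relabeling $n_i\mapsto i$ (labels $0,\ldots,k-1$). Isomorphism is of edge-weighted graphs (preserving adjacency and weights). -}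

module Defs where

open import Data.Nat using (ℕ)
open import Data.Fin using (Fin; toℕ; _<_)
open import Data.Product using (_×_; ∃-syntax; Σ)
open import Relation.Binary.PropositionalEquality using (_≡_)
open import Relation.Nullary using (¬_)
open import Relation.Binary.Construct.Closure.ReflexiveTransitive using (Star)

_⟺_ : Set → Set → Set
P ⟺ Q = (P → Q) × (Q → P)

record WGraph (R : Set) : Set₁ where
  field
    m   : ℕ
    Adj : Fin m → Fin m → Set
    wt  : Fin m → Fin m → R
open WGraph public

module _ {R : Set} (0R : R) where

  -- The sequence is given as a : ℕ → R; only a_0,…,a_{2n-2} are ever used,
  -- since i+j ≤ 2n-2 for i,j ∈ Fin n.
  -- i ~ j iff i+j ∈ T_A, i.e. a_{i+j} ≠ 0; weight w_A(i+j) = a_{i+j}.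
  HankelGraph : (n : ℕ) → (ℕ → R) → WGraph R
  HankelGraph n a = record
    { m   = n
    ; Adj = λ i j → ¬ (a (toℕ i + toℕ j) ≡ 0R)
    ; wt  = λ i j → a (toℕ i + toℕ j)
    }
    where open import Data.Nat using (_+_)

Connected : {R : Set} (G : WGraph R) → Fin (m G) → Fin (m G) → Set
Connected G = Star (Adj G)

IsNormalizedLabelingOfComponent : {R : Set} (G : WGraph R) (v : Fin (m G))
  (k : ℕ) (f : Fin k → Fin (m G)) → Set
IsNormalizedLabelingOfComponent G v k f =
  (∀ i j → i < j → f i < f j) ×
  (∀ u → Connected G v u ⟺ (∃[ i ] f i ≡ u))

-- The component (a maximal connected subgraph, hence containing every edge of G
-- between its vertices) relabeled by f: vertex i stands for f i.
Relabel : {R : Set} (G : WGraph R) (k : ℕ) (f : Fin k → Fin (m G)) → WGraph R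
Relabel G k f = record
  { m   = k
  ; Adj = λ i j → Adj G (f i) (f j)
  ; wt  = λ i j → wt G (f i) (f j)
  }

IsWIso : {R : Set} (G H : WGraph R) (φ : Fin (m G) → Fin (m H)) → Set
IsWIso G H φ =
  (Σ (Fin (m H) → Fin (m G)) λ ψ → (∀ x → ψ (φ x) ≡ x) × (∀ y → φ (ψ y) ≡ y)) ×
  (∀ i j → Adj G i j ⟺ Adj H (φ i) (φ j)) ×
  (∀ i j → Adj G i j → wt G i j ≡ wt H (φ i) (φ j))

-- Let n₀ < ⋯ < n_{k-1} be the vertices of a component, and put g i = nᵢ.
-- If a_s ≠ 0 and s = g(i+1) + g j, then the neighbours s − g(j+1) and s − g i
-- of the vertices g(j+1) and g i lie in the component, and squeezing them
-- between consecutive values of g forces s = g i + g(j+1).  Iterating this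
-- exchange, whenever a_{g i + g j} ≠ 0 the sum g i + g j depends only on i + j,
-- so b_s := a_{g i' + g j'} for one fixed split s = i' + j' is a Hankel sequence
-- for the relabelled component.
module Submission where

open import Defs
open import Data.Nat using (ℕ; zero; suc; pred; _+_; _∸_; _⊓_; _≤_; _<_; _≤?_; _<?_; s≤s)
open import Data.Nat.Properties
open import Data.Fin using (Fin; toℕ; fromℕ<)
open import Data.Fin.Properties using (toℕ<n; fromℕ<-toℕ; toℕ-fromℕ<)
open import Data.Product using (∃-syntax; _,_; proj₁; proj₂; _×_)
open import Relation.Binary.PropositionalEquality
open import Function using (_∘_)
open import Relation.Nullary using (¬_; yes; no)
open import Relation.Nullary.Negation using (contradiction)
open import Relation.Binary.Construct.Closure.ReflexiveTransitive using (ε; _◅_; _◅◅_)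

m≤n<m+o⇒n∸m<o : ∀ {m n o} → m ≤ n → n < m + o → n ∸ m < o
m≤n<m+o⇒n∸m<o {m} {n} {o} m≤n n<m+o = subst (n ∸ m <_) (m+n∸m≡n m o) (∸-monoˡ-< n<m+o m≤n)

pred⊓-∸pred-< : ∀ {k i j} → i < k → j < k → pred k ⊓ (i + j) < k × (i + j) ∸ pred k < k
pred⊓-∸pred-< {suc c} {i} {j} (s≤s i≤c) (s≤s j≤c) =
  s≤s (m⊓n≤m c (i + j)) ,
  s≤s (≤-trans (∸-monoˡ-≤ c (+-mono-≤ i≤c j≤c)) (≤-reflexive (m+n∸n≡m c c)))

module ClosedIncreasingSequence
    (P : ℕ → Set) {k n : ℕ} (g : ℕ → ℕ)
    (g-mono-< : ∀ {i j} → i < j → j < k → g i < g j)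
    (g<n : ∀ {i} → i < k → g i < n)
    (closed : ∀ {t s} → t < k → P s → g t ≤ s → s < g t + n →
              ∃[ t′ ] t′ < k × g t + g t′ ≡ s)
    where

  g-mono-≤ : ∀ {i j} → i ≤ j → j < k → g i ≤ g j
  g-mono-≤ {i} {j} i≤j j<k with i ≟ j
  ... | yes refl = ≤-refl
  ... | no  i≢j  = <⇒≤ (g-mono-< (≤∧≢⇒< i≤j i≢j) j<k)

  g-cancel-< : ∀ {i j} → i < k → g i < g j → i < j
  g-cancel-< {i} {j} i<k gi<gj with j ≤? i
  ... | yes j≤i = contradiction (g-mono-≤ j≤i i<k) (<⇒≱ gi<gj)
  ... | no  j≰i = ≰⇒> j≰i

  module Exchange {i j s} (si<k : suc i < k) (sj<k : suc j < k) (Ps : P s)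
      (s≡ : g (suc i) + g j ≡ s) where
    open ≤-Reasoning

    i<k : i < k
    i<k = <-trans (n<1+n i) si<k

    gi<gsi : g i < g (suc i)
    gi<gsi = g-mono-< (n<1+n i) si<k

    gj<gsj : g j < g (suc j)
    gj<gsj = g-mono-< (n<1+n j) sj<k

    gi≤s : g i ≤ s
    gi≤s = subst (g i ≤_) s≡ (≤-trans (<⇒≤ gi<gsi) (m≤m+n (g (suc i)) (g j)))

    s<gsj+n : s < g (suc j) + n
    s<gsj+n = subst (_< g (suc j) + n) (trans (+-comm (g j) (g (suc i))) s≡)
                    (+-mono-< gj<gsj (g<n si<k))

    s≤gi+gsj : s ≤ g i + g (suc j)
    s≤gi+gsj with g (suc j) ≤? s
    ... | no gsj≰s = ≤-trans (<⇒≤ (≰⇒> gsj≰s)) (m≤n+m (g (suc j)) (g i))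
    ... | yes gsj≤s with closed sj<k Ps gsj≤s s<gsj+n
    ...   | t , t<k , gsj+gt≡s = begin
        s               ≡⟨ sym gsj+gt≡s ⟩
        g (suc j) + g t ≤⟨ +-monoʳ-≤ (g (suc j)) (g-mono-≤ (<⇒≤pred t<si) i<k) ⟩
        g (suc j) + g i ≡⟨ +-comm (g (suc j)) (g i) ⟩
        g i + g (suc j) ∎
      where
        gt<gsi : g t < g (suc i)
        gt<gsi = +-cancelˡ-< (g (suc j)) (g t) (g (suc i)) (begin-strict
          g (suc j) + g t       ≡⟨ gsj+gt≡s ⟩
          s                     ≡⟨ sym s≡ ⟩
          g (suc i) + g j       <⟨ +-monoʳ-< (g (suc i)) gj<gsj ⟩
          g (suc i) + g (suc j) ≡⟨ +-comm (g (suc i)) (g (suc j)) ⟩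
          g (suc j) + g (suc i) ∎)
        t<si : t < suc i
        t<si = g-cancel-< t<k gt<gsi

    gi+gsj≤s : s < g i + n → g i + g (suc j) ≤ s
    gi+gsj≤s s<gi+n with closed i<k Ps gi≤s s<gi+n
    ... | t , t<k , gi+gt≡s = begin
        g i + g (suc j) ≤⟨ +-monoʳ-≤ (g i) (g-mono-≤ sj≤t t<k) ⟩
        g i + g t       ≡⟨ gi+gt≡s ⟩
        s               ∎
      where
        gj<gt : g j < g t
        gj<gt = +-cancelˡ-< (g i) (g j) (g t) (begin-strict
          g i + g j       ≡⟨ +-comm (g i) (g j) ⟩
          g j + g i       <⟨ +-monoʳ-< (g j) gi<gsi ⟩
          g j + g (suc i) ≡⟨ trans (+-comm (g j) (g (suc i))) s≡ ⟩
          s               ≡⟨ sym gi+gt≡s ⟩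
          g i + g t       ∎)
        sj≤t : suc j ≤ t
        sj≤t = g-cancel-< (<-trans (n<1+n j) sj<k) gj<gt

    -- The upper bound s < g i + n needed for the second estimate comes from the first.
    exchange : g i + g (suc j) ≡ s
    exchange = ≤-antisym (gi+gsj≤s s<gi+n) s≤gi+gsj
      where
        s<gi+n : s < g i + n
        s<gi+n = ≤-<-trans s≤gi+gsj (+-monoʳ-< (g i) (g<n sj<k))

  open Exchange using (exchange)

  shift : ∀ d {i j s} → i + d < k → j + d < k → P s →
          g (i + d) + g j ≡ s → g i + g (j + d) ≡ s
  shift zero {i} {j} _ _ _ s≡ rewrite +-identityʳ i | +-identityʳ j = s≡
  shift (suc d) {i} {j} {s} i+sd<k j+sd<k Ps s≡ =
      subst (λ x → g i + g x ≡ s) (sym (+-suc j d))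
        (exchange si<k (subst (_< k) (+-suc j d) j+sd<k) Ps
          (shift d si+d<k j+d<k Ps (subst (λ x → g x + g j ≡ s) (+-suc i d) s≡)))
    where
      si+d<k : suc i + d < k
      si+d<k = subst (_< k) (+-suc i d) i+sd<k
      si<k : suc i < k
      si<k = ≤-<-trans (m≤m+n (suc i) d) si+d<k
      j+d<k : j + d < k
      j+d<k = <-trans (n<1+n (j + d)) (subst (_< k) (+-suc j d) j+sd<k)

  sum-invariant-≤ : ∀ {i j i′ j′} → i < k → j′ < k → i′ ≤ i →
                    i + j ≡ i′ + j′ → P (g i + g j) → g i′ + g j′ ≡ g i + g j
  sum-invariant-≤ {i} {j} {i′} {j′} i<k j′<k i′≤i ij≡ Ps =
      subst (λ x → g i′ + g x ≡ g i + g j) j+d≡j′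
        (shift d (subst (_< k) (sym i′+d≡i) i<k) (subst (_< k) (sym j+d≡j′) j′<k) Ps
          (cong (λ x → g x + g j) i′+d≡i))
    where
      open ≡-Reasoning
      d : ℕ
      d = i ∸ i′
      i′+d≡i : i′ + d ≡ i
      i′+d≡i = m+[n∸m]≡n i′≤i
      j+d≡j′ : j + d ≡ j′
      j+d≡j′ = +-cancelˡ-≡ i′ (j + d) j′ (begin
        i′ + (j + d) ≡⟨ cong (i′ +_) (+-comm j d) ⟩
        i′ + (d + j) ≡⟨ sym (+-assoc i′ d j) ⟩
        i′ + d + j   ≡⟨ cong (_+ j) i′+d≡i ⟩
        i + j        ≡⟨ ij≡ ⟩
        i′ + j′      ∎)

  sum-invariant : ∀ {i j i′ j′} → i < k → j < k → i′ < k → j′ < k →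
                  i + j ≡ i′ + j′ → P (g i + g j) → g i′ + g j′ ≡ g i + g j
  sum-invariant {i} {j} {i′} {j′} i<k j<k i′<k j′<k ij≡ Ps with i′ ≤? i
  ... | yes i′≤i = sum-invariant-≤ i<k j′<k i′≤i ij≡ Ps
  ... | no  i′≰i = begin
      g i′ + g j′ ≡⟨ +-comm (g i′) (g j′) ⟩
      g j′ + g i′ ≡⟨ sum-invariant-≤ j<k i′<k j′≤j ji≡ (subst P (+-comm (g i) (g j)) Ps) ⟩
      g j + g i   ≡⟨ +-comm (g j) (g i) ⟩
      g i + g j   ∎
    where
      open ≡-Reasoning
      ji≡ : j + i ≡ j′ + i′
      ji≡ = trans (+-comm j i) (trans ij≡ (+-comm i′ j′))
      j′≤j : j′ ≤ j
      j′≤j = ≮⇒≥ (λ j<j′ → <-irrefl ij≡ (+-mono-< (≰⇒> i′≰i) j<j′))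

module Component {R : Set} (0R : R) (n : ℕ) (a : ℕ → R) (v : Fin n)
    (k : ℕ) (f : Fin k → Fin n)
    (f-normalized : IsNormalizedLabelingOfComponent (HankelGraph 0R n a) v k f) where

  Nonzero : ℕ → Set
  Nonzero s = ¬ a s ≡ 0R

  -- Extended by 0 beyond k, so that index arithmetic can be done in ℕ.
  g : ℕ → ℕ
  g m with m <? k
  ... | yes m<k = toℕ (f (fromℕ< m<k))
  ... | no  _   = 0

  g-fromℕ< : ∀ {m} (m<k : m < k) → g m ≡ toℕ (f (fromℕ< m<k))
  g-fromℕ< {m} m<k with m <? k
  ... | yes _   = refl
  ... | no  m≮k = contradiction m<k m≮k

  g-toℕ : (i : Fin k) → g (toℕ i) ≡ toℕ (f i)
  g-toℕ i = trans (g-fromℕ< (toℕ<n i)) (cong (toℕ ∘ f) (fromℕ<-toℕ i (toℕ<n i)))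

  g-mono-< : ∀ {i j} → i < j → j < k → g i < g j
  g-mono-< {i} {j} i<j j<k =
    subst₂ _<_ (sym (g-fromℕ< i<k)) (sym (g-fromℕ< j<k))
      (proj₁ f-normalized (fromℕ< i<k) (fromℕ< j<k)
        (subst₂ _<_ (sym (toℕ-fromℕ< i<k)) (sym (toℕ-fromℕ< j<k)) i<j))
    where
      i<k : i < k
      i<k = <-trans i<j j<k

  g<n : ∀ {i} → i < k → g i < n
  g<n i<k = subst (_< n) (sym (g-fromℕ< i<k)) (toℕ<n (f (fromℕ< i<k)))

  neighbour-in-component : (i : Fin k) (u : Fin n) → Nonzero (toℕ (f i) + toℕ u) → ∃[ i′ ] f i′ ≡ u
  neighbour-in-component i u fi-adj-u =
    proj₁ (proj₂ f-normalized u) (proj₂ (proj₂ f-normalized (f i)) (i , refl) ◅◅ (fi-adj-u ◅ ε))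

  closed : ∀ {t s} → t < k → Nonzero s → g t ≤ s → s < g t + n →
           ∃[ t′ ] t′ < k × g t + g t′ ≡ s
  closed {t} {s} t<k as≢0 gt≤s s<gt+n = index-of (neighbour-in-component (fromℕ< t<k) u ft+u-adj)
    where
      open ≡-Reasoning
      u : Fin n
      u = fromℕ< (m≤n<m+o⇒n∸m<o gt≤s s<gt+n)
      gt+u≡s : g t + toℕ u ≡ s
      gt+u≡s = trans (cong (g t +_) (toℕ-fromℕ< _)) (m+[n∸m]≡n gt≤s)
      ft+u-adj : Nonzero (toℕ (f (fromℕ< t<k)) + toℕ u)
      ft+u-adj = subst Nonzero (sym (trans (cong (_+ toℕ u) (sym (g-fromℕ< t<k))) gt+u≡s)) as≢0
      index-of : ∃[ i ] f i ≡ u → ∃[ t′ ] t′ < k × g t + g t′ ≡ s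
      index-of (i , fi≡u) = toℕ i , toℕ<n i , (begin
        g t + g (toℕ i) ≡⟨ cong (g t +_) (trans (g-toℕ i) (cong toℕ fi≡u)) ⟩
        g t + toℕ u     ≡⟨ gt+u≡s ⟩
        s               ∎)

  open ClosedIncreasingSequence Nonzero g g-mono-< g<n closed using (sum-invariant)

  -- s = (pred k ⊓ s) + (s ∸ pred k) splits every s ≤ 2k − 2 into two indices below k.
  b : ℕ → R
  b s = a (g (pred k ⊓ s) + g (s ∸ pred k))

  module _ (i j : Fin k) where

    split-< : pred k ⊓ (toℕ i + toℕ j) < k × (toℕ i + toℕ j) ∸ pred k < k
    split-< = pred⊓-∸pred-< (toℕ<n i) (toℕ<n j)

    split-sum : pred k ⊓ (toℕ i + toℕ j) + (toℕ i + toℕ j ∸ pred k) ≡ toℕ i + toℕ j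
    split-sum = m⊓n+n∸m≡n (pred k) (toℕ i + toℕ j)

    fi+fj≡ : toℕ (f i) + toℕ (f j) ≡ g (toℕ i) + g (toℕ j)
    fi+fj≡ = sym (cong₂ _+_ (g-toℕ i) (g-toℕ j))

    weight-eq : Nonzero (toℕ (f i) + toℕ (f j)) → a (toℕ (f i) + toℕ (f j)) ≡ b (toℕ i + toℕ j)
    weight-eq nz = cong a (trans fi+fj≡ (sym
      (sum-invariant (toℕ<n i) (toℕ<n j) (proj₁ split-<) (proj₂ split-<) (sym split-sum)
        (subst Nonzero fi+fj≡ nz))))

    adjacent-iff : Nonzero (toℕ (f i) + toℕ (f j)) ⟺ (¬ b (toℕ i + toℕ j) ≡ 0R)
    adjacent-iff = (λ nz → subst (λ x → ¬ x ≡ 0R) (weight-eq nz) nz)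
                 , (λ nz → subst Nonzero (trans (sym
                     (sum-invariant (proj₁ split-<) (proj₂ split-<) (toℕ<n i) (toℕ<n j) split-sum nz))
                     (sym fi+fj≡)) nz)

theorem4p2 : {R : Set} (0R : R) (n : ℕ) (a : ℕ → R) (v : Fin n)
    (k : ℕ) (f : Fin k → Fin n) →
    IsNormalizedLabelingOfComponent (HankelGraph 0R n a) v k f →
    ∃[ b ] IsWIso (Relabel (HankelGraph 0R n a) k f) (HankelGraph 0R k b) (λ i → i)
theorem4p2 0R n a v k f f-normalized =
  b , ((λ i → i) , (λ _ → refl) , (λ _ → refl)) , adjacent-iff , weight-eq
  where open Component 0R n a v k f f-normalized
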